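{- Let $G$ be a connected graph whose boundary $\partial(G)$ equals its set of simplicial vertices. Then $pd_s(G)=|\partial(G)|$. In particular: (i) for any positive integer $n$, $pd_s(K_n)=n$; (ii) for any tree $T$ with $l(T)$ leaves, $pd_s(T)=l(T)$; (iii) for any connected block graph $G$ of order $n$ with $c$ cut vertices, $pd_s(G)=n-c$.
   Context: Graphs are finite, simple, connected; $d_G$ is shortest-path distance, $d_G(x,W)=\min\{d_G(x,w):w\in W\}$. A set $W$ strongly resolves different vertices $x,y\notin W$ if $d_G(x,W)=d_G(x,y)+d_G(y,W)$ or $d_G(y,W)=d_G(y,x)+d_G(x,W)$. A vertex partition $\Pi$ is a strong resolving partition if every two different vertices in the same set of $\Pi$ are strongly resolved by some set of $\Pi$; $pd_s(G)$ is the minimum cardinality of such a partition. A vertex $u$ is maximally distant from $v$ if $d_G(v,w)\le d_G(u,v)$ for every neighbor $w$ of $u$; $u,v$ are mutually maximally distant if each is maximally distant from the other. The boundary $\partial(G)$ is the set of vertices $u$ for which some $v$ exists with $u,v$ mutually maximally distant. A vertex is simplicial if its neighbors induce a complete graph. A block graph is a graph in which every block (biconnected component) is a clique. -}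

module Defs where

open import Data.Nat using (ℕ; zero; suc; _+_; _≤_; _≡ᵇ_)
open import Data.Bool using (Bool; true; false; T; not)
open import Data.Fin using (Fin; zero; suc; inject₁; fromℕ; _≟_)
open import Data.Fin.Subset using (Subset; ∣_∣; _∈_; _⊆_)
open import Data.Vec using (tabulate)
open import Data.Product using (Σ; ∃; ∃-syntax; _×_; _,_)
open import Data.Sum using (_⊎_)
open import Data.Unit using (⊤)
open import Function.Definitions using (Injective)
open import Relation.Nullary using (¬_; yes; no; Dec)
open import Relation.Nullary.Decidable using (⌊_⌋)
open import Relation.Binary.PropositionalEquality using (_≡_; _≢_; refl; sym)

record Graph : Set where
  field
    n      : ℕ
    adj    : Fin n → Fin n → Bool
    irrefl : ∀ x → adj x x ≡ false
    symm   : ∀ x y → adj x y ≡ adj y x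

open Graph public

module _ (G : Graph) where

  Adj : Fin (n G) → Fin (n G) → Set
  Adj x y = T (adj G x y)

  data WalkIn (P : Fin (n G) → Set) : Fin (n G) → Fin (n G) → ℕ → Set where
    here : ∀ {x} → P x → WalkIn P x x 0
    step : ∀ {x y z k} → P x → Adj x y → WalkIn P y z k → WalkIn P x z (suc k)

  Walk : Fin (n G) → Fin (n G) → ℕ → Set
  Walk = WalkIn (λ _ → ⊤)

  Connected : Set
  Connected = ∀ x y → ∃[ k ] Walk x y k

  IsDist : Fin (n G) → Fin (n G) → ℕ → Set
  IsDist x y k = Walk x y k × (∀ m → Walk x y m → k ≤ m)

  IsSetDist : Fin (n G) → (Fin (n G) → Set) → ℕ → Set
  IsSetDist x W k =
    (∃[ w ] (W w × IsDist x w k)) × (∀ w → W w → ∀ m → IsDist x w m → k ≤ m)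

  Through : (Fin (n G) → Set) → Fin (n G) → Fin (n G) → Set
  Through W x y = ∃[ a ] ∃[ b ] ∃[ c ]
    (IsSetDist x W a × IsDist x y b × IsSetDist y W c × a ≡ b + c)

  StronglyResolves : (Fin (n G) → Set) → Fin (n G) → Fin (n G) → Set
  StronglyResolves W x y = ¬ W x × ¬ W y × (Through W x y ⊎ Through W y x)

  -- a partition into k (nonempty) classes, given by a surjective labelling
  IsPartition : (k : ℕ) → (Fin (n G) → Fin k) → Set
  IsPartition k f = ∀ i → ∃[ v ] f v ≡ i

  Class : {k : ℕ} → (Fin (n G) → Fin k) → Fin k → Fin (n G) → Set
  Class f i v = f v ≡ i

  IsStrongResolvingPartition : (k : ℕ) → (Fin (n G) → Fin k) → Set
  IsStrongResolvingPartition k f = IsPartition k f ×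
    (∀ x y → x ≢ y → f x ≡ f y → ∃[ i ] StronglyResolves (Class f i) x y)

  HasSRP : ℕ → Set
  HasSRP k = ∃[ f ] IsStrongResolvingPartition k f

  PDs : ℕ → Set
  PDs m = HasSRP m × (∀ k → HasSRP k → m ≤ k)

  MaximallyDistant : Fin (n G) → Fin (n G) → Set
  MaximallyDistant u v =
    ∀ w → Adj u w → ∀ a b → IsDist v w a → IsDist u v b → a ≤ b

  MutuallyMaximallyDistant : Fin (n G) → Fin (n G) → Set
  MutuallyMaximallyDistant u v = MaximallyDistant u v × MaximallyDistant v u

  InBoundary : Fin (n G) → Set
  InBoundary u = ∃[ v ] MutuallyMaximallyDistant u v

  Simplicial : Fin (n G) → Set
  Simplicial u = ∀ a b → Adj u a → Adj u b → a ≢ b → Adj a b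

  HasCycle : Set
  -- a cycle v_0 v_1 ... v_{m+2} v_0 of m+3 ≥ 3 distinct vertices
  HasCycle = Σ ℕ λ m → Σ (Fin (suc (suc (suc m))) → Fin (n G)) λ vs →
     Injective _≡_ _≡_ vs ×
     ((i : Fin (suc (suc m))) → Adj (vs (inject₁ i)) (vs (suc i))) ×
     Adj (vs (fromℕ (suc (suc m)))) (vs zero)

  IsTree : Set
  IsTree = Connected × ¬ HasCycle

  degree : Fin (n G) → ℕ
  degree u = ∣ tabulate (adj G u) ∣

  leaves : Subset (n G)
  leaves = tabulate (λ u → degree u ≡ᵇ 1)

  IsCutVertex : Fin (n G) → Set
  IsCutVertex v = ∃[ x ] ∃[ y ] (x ≢ v × y ≢ v ×
    ¬ (∃[ k ] WalkIn (λ w → w ≢ v) x y k))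

  Nonseparable : Subset (n G) → Set
  Nonseparable B =
    (∀ x y → x ∈ B → y ∈ B → ∃[ k ] WalkIn (_∈ B) x y k) ×
    (∀ v x y → v ∈ B → x ∈ B → y ∈ B → x ≢ v → y ≢ v →
       ∃[ k ] WalkIn (λ w → w ∈ B × w ≢ v) x y k)

  IsBlock : Subset (n G) → Set
  IsBlock B = (∃[ v ] v ∈ B) × Nonseparable B ×
    (∀ B' → Nonseparable B' → B ⊆ B' → B' ⊆ B)

  IsBlockGraph : Set
  IsBlockGraph = ∀ B → IsBlock B → ∀ x y → x ∈ B → y ∈ B → x ≢ y → Adj x y

private
  neq : ∀ {m} → Fin m → Fin m → Bool
  neq x y = not ⌊ x ≟ y ⌋

  neq-irr : ∀ {m} (x : Fin m) → neq x x ≡ false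
  neq-irr x with x ≟ x
  ... | yes _ = refl
  ... | no p = Data.Empty.⊥-elim (p refl)
    where import Data.Empty

  neq-sym : ∀ {m} (x y : Fin m) → neq x y ≡ neq y x
  neq-sym x y with x ≟ y | y ≟ x
  ... | yes _ | yes _ = refl
  ... | no _  | no _  = refl
  ... | yes p | no q  = Data.Empty.⊥-elim (q (sym p))
    where import Data.Empty
  ... | no p  | yes q = Data.Empty.⊥-elim (p (sym q))
    where import Data.Empty

K : ℕ → Graph
K m = record { n = m ; adj = neq ; irrefl = neq-irr ; symm = neq-sym }

-- All parts follow from pd-simplicial: if G is connected and every vertex
-- maximally distant from some vertex is simplicial, pd_s(G) is the number of
-- simplicial vertices.  Lower bound (module Extremal): a simplicial vertex
-- never lies between another vertex and a set avoiding it, so simplicial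
-- vertices lie in pairwise different classes.  Upper bound (module Upper):
-- each simplicial vertex gets its own class, all other vertices join the
-- first one; two vertices x, y of the first class are resolved by a
-- simplicial vertex beyond y seen from x, or beyond x seen from y (a farthest
-- such vertex is maximally distant, hence simplicial); these two differ, so
-- one of them has a class of its own.
-- The instances then only need "maximally distant ⇒ simplicial" and a count
-- of the simplicial vertices.  For trees and block graphs, two neighbours of
-- a maximally distant w are joined avoiding w, closing a cycle: impossible in
-- a tree, and inside a clique block of a block graph.
module Submission where

open import Defs
open import Data.Nat using (ℕ; zero; suc; _+_; _∸_; _≤_; _<_; z≤n; s≤s; _≡ᵇ_)
open import Data.Nat.Properties
open import Data.Bool using (Bool; T)
open import Data.Bool.Properties using (T?; T-≡)
open import Data.Fin using (Fin; zero; suc; toℕ; inject₁; fromℕ; fromℕ<)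
import Data.Fin.Properties as Finₚ
open import Data.Fin.Subset using (Subset; inside; outside; ∣_∣; _∈_; _⊆_; _⊃_; ∁; ⁅_⁆)
open import Data.Fin.Subset.Properties
  using (_∈?_; x∈p⇒∣p-x∣<∣p∣; x∈p∧x≢y⇒x∈p-y; p⊆q⇒∣p∣≤∣q∣; ∣⁅x⁆∣≡1; x∈⁅x⁆; x∈∁p⇒x∉p; x∉p⇒x∈∁p; ∣∁p∣≡n∸∣p∣)
open import Data.Fin.Subset.Induction using (⊃-wellFounded; Acc; acc)
open import Data.Vec using (tabulate; _∷_; []; here; there)
open import Data.Vec.Properties using ([]=⇒lookup; lookup⇒[]=; lookup∘tabulate)
open import Data.List using (List; allFin; filter)
import Data.List.Relation.Unary.All as All
open import Data.List.Relation.Unary.All.Properties using (all-filter)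
open import Data.List.Membership.Propositional.Properties using (∈-filter⁺; ∈-allFin)
open import Data.List.Extrema.Nat using (argmax; argmax-all; f[xs]≤f[argmax])
open import Data.Product using (Σ; ∃-syntax; _×_; _,_; proj₁; proj₂)
open import Data.Sum using (_⊎_; inj₁; inj₂; swap)
open import Data.Unit using (tt)
open import Data.Empty using (⊥; ⊥-elim)
open import Function using (_∘_)
open import Function.Definitions using (Injective)
open import Function.Bundles using (_⇔_; Equivalence; mk⇔)
open import Function.Construct.Composition using (_⇔-∘_)
open import Relation.Nullary using (¬_; yes; no; Dec; ¬?)
open import Relation.Nullary.Decidable using (_×-dec_; _⊎-dec_; ⌊_⌋; toWitness; fromWitness)
open import Relation.Unary using (Decidable)
open import Relation.Binary.PropositionalEquality
open import Relation.Binary.Definitions using (tri<; tri≈; tri>)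

least : {P : ℕ → Set} → Decidable P → ∀ k → P k → ∃[ m ] P m × (∀ j → P j → m ≤ j)
least P? zero p = 0 , p , λ _ _ → z≤n
least {P} P? (suc k) p with P? 0
... | yes p₀ = 0 , p₀ , λ _ _ → z≤n
... | no ¬p₀ with least (P? ∘ suc) k p
...   | m , pm , minimal = suc m , pm , below
  where
  below : ∀ j → P j → suc m ≤ j
  below zero    p₀ = ⊥-elim (¬p₀ p₀)
  below (suc j) pj = s≤s (minimal j pj)

maximiser : ∀ {N} {P : Fin N → Set} → Decidable P → (g : Fin N → ℕ) →
            ∀ {u₀} → P u₀ → ∃[ w ] P w × (∀ u → P u → g u ≤ g w)
maximiser {N} P? g {u₀} pu₀ =
  argmax g u₀ candidates ,
  argmax-all g pu₀ (all-filter P? (allFin N)) ,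
  λ u pu → All.lookup (f[xs]≤f[argmax] u₀ candidates) (∈-filter⁺ P? (∈-allFin u) pu)
  where
  candidates : List (Fin N)
  candidates = filter P? (allFin N)

-- A listing of the elements of Fin N satisfying S: an injective map from
-- Fin m onto them.  Its length m is the cardinality of S.
record Listing {N : ℕ} (S : Fin N → Set) (m : ℕ) : Set where
  field
    elem           : Fin m → Fin N
    elem-injective : Injective _≡_ _≡_ elem
    elem-sat       : ∀ i → S (elem i)
    elem-onto      : ∀ {v} → S v → ∃[ i ] elem i ≡ v

relist : ∀ {N m} {S S′ : Fin N → Set} → (∀ v → S v ⇔ S′ v) → Listing S m → Listing S′ m
relist S⇔S′ L = record
  { elem           = elem
  ; elem-injective = elem-injective
  ; elem-sat       = λ i → Equivalence.to (S⇔S′ (elem i)) (elem-sat i)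
  ; elem-onto      = λ s → elem-onto (Equivalence.from (S⇔S′ _) s)
  }
  where open Listing L

enumerate : ∀ {N} (p : Subset N) → Listing (_∈ p) ∣ p ∣
enumerate {zero} [] = record
  { elem = λ () ; elem-injective = λ {i} → ⊥-elim (Finₚ.¬Fin0 i) ; elem-sat = λ () ; elem-onto = λ () }
enumerate {suc N} (outside ∷ p) = record
  { elem           = suc ∘ elem
  ; elem-injective = elem-injective ∘ Finₚ.suc-injective
  ; elem-sat       = there ∘ elem-sat
  ; elem-onto      = λ { (there v∈p) → let (i , e) = elem-onto v∈p in i , cong suc e }
  }
  where open Listing (enumerate p)
enumerate {suc N} (inside ∷ p) = record
  { elem           = elem′
  ; elem-injective = injective
  ; elem-sat       = λ { zero → here ; (suc i) → there (elem-sat i) }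
  ; elem-onto      = λ { {zero} _ → zero , refl
                       ; {suc v} (there v∈p) → let (i , e) = elem-onto v∈p in suc i , cong suc e }
  }
  where
  open Listing (enumerate p)
  elem′ : Fin (suc ∣ p ∣) → Fin (suc N)
  elem′ zero    = zero
  elem′ (suc i) = suc (elem i)
  injective : Injective _≡_ _≡_ elem′
  injective {zero}  {zero}  _ = refl
  injective {suc i} {suc j} e = cong suc (elem-injective (Finₚ.suc-injective e))

∈-tabulate⁺ : ∀ {N} (f : Fin N → Bool) {v} → T (f v) → v ∈ tabulate f
∈-tabulate⁺ f {v} t = lookup⇒[]= v (tabulate f) (trans (lookup∘tabulate f v) (Equivalence.to T-≡ t))

∈-tabulate⁻ : ∀ {N} (f : Fin N → Bool) {v} → v ∈ tabulate f → T (f v)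
∈-tabulate⁻ f {v} v∈ = Equivalence.from T-≡ (trans (sym (lookup∘tabulate f v)) ([]=⇒lookup v∈))

adj-sym : (G : Graph) {x y : Fin (n G)} → Adj G x y → Adj G y x
adj-sym G {x} {y} = subst T (symm G x y)

adj-irrefl : (G : Graph) {x : Fin (n G)} → ¬ Adj G x x
adj-irrefl G {x} = subst T (irrefl G x)

adj⇒≢ : (G : Graph) {u a : Fin (n G)} → Adj G u a → a ≢ u
adj⇒≢ G ua a≡u = adj-irrefl G (subst (Adj G _) a≡u ua)

swap-resolves : (G : Graph) {W : Fin (n G) → Set} {x y : Fin (n G)} →
                StronglyResolves G W x y → StronglyResolves G W y x
swap-resolves G (x∉W , y∉W , through) = y∉W , x∉W , swap through

module Walks (G : Graph) {P : Fin (n G) → Set} where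

  private
    V = Fin (n G)
    WalkP = WalkIn G P

  _++_ : ∀ {x y z a b} → WalkP x y a → WalkP y z b → WalkP x z (a + b)
  here _       ++ q = q
  step px e p  ++ q = step px e (p ++ q)

  snoc : ∀ {x y z k} → WalkP x y k → P z → Adj G y z → WalkP x z (suc k)
  snoc (here px)      pz e′ = step px e′ (here pz)
  snoc (step px e p)  pz e′ = step px e (snoc p pz e′)

  reverse : ∀ {x y k} → WalkP x y k → WalkP y x k
  reverse (here px)     = here px
  reverse (step px e p) = snoc (reverse p) px (adj-sym G e)

  meet : ∀ {x y h} → ∃[ i ] WalkP x h i → ∃[ j ] WalkP y h j → ∃[ k ] WalkP x y k
  meet (_ , p) (_ , q) = _ , p ++ reverse q

  -- the l-th vertex of a walk (the last one for l beyond its length)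
  vertex : ∀ {x y k} → WalkP x y k → ℕ → V
  vertex {x} _            zero    = x
  vertex {x} (here _)     (suc l) = x
  vertex     (step _ _ p) (suc l) = vertex p l

  vertex-sat : ∀ {x y k} (p : WalkP x y k) l → P (vertex p l)
  vertex-sat (here px)     zero    = px
  vertex-sat (step px _ _) zero    = px
  vertex-sat (here px)     (suc l) = px
  vertex-sat (step _ _ p)  (suc l) = vertex-sat p l

  vertex-last : ∀ {x y k} (p : WalkP x y k) → vertex p k ≡ y
  vertex-last (here _)     = refl
  vertex-last (step _ _ p) = vertex-last p

  vertex-adj : ∀ {x y k} (p : WalkP x y k) l → l < k → Adj G (vertex p l) (vertex p (suc l))
  vertex-adj (step _ e p) zero    _         = e
  vertex-adj (step _ e p) (suc l) (s≤s l<k) = vertex-adj p l l<k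

  segment : ∀ {x y k} (p : WalkP x y k) (Q : V → Set) i j → i ≤ j → j ≤ k →
            (∀ l → i ≤ l → l ≤ j → Q (vertex p l)) →
            WalkIn G Q (vertex p i) (vertex p j) (j ∸ i)
  segment p            Q zero    zero    _         _         q = here (q 0 z≤n z≤n)
  segment (step _ e p) Q zero    (suc j) _         (s≤s j≤k) q =
    step (q 0 z≤n z≤n) e (segment p Q zero j z≤n j≤k (λ l _ l≤j → q (suc l) z≤n (s≤s l≤j)))
  segment (step _ e p) Q (suc i) (suc j) (s≤s i≤j) (s≤s j≤k) q =
    segment p Q i j i≤j j≤k (λ l i≤l l≤j → q (suc l) (s≤s i≤l) (s≤s l≤j))

  shortcut : ∀ {x y k} (p : WalkP x y k) i j → i < j → j ≤ k → vertex p i ≡ vertex p j →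
             ∃[ m ] m < k × WalkP x y m
  shortcut {x} {y} {k} p i j i<j j≤k same =
    i + (k ∸ j) ,
    subst (i + (k ∸ j) <_) (m+[n∸m]≡n j≤k) (+-monoˡ-< (k ∸ j) i<j) ,
    subst (λ u → WalkP x u (i + (k ∸ j))) (vertex-last p)
      (subst (λ u → WalkP x u i) same (segment p P 0 i z≤n (≤-trans (<⇒≤ i<j) j≤k) on-walk)
        ++ segment p P j k j≤k ≤-refl on-walk)
    where
    on-walk : ∀ {a b} l → a ≤ l → l ≤ b → P (vertex p l)
    on-walk l _ _ = vertex-sat p l

  walk? : Decidable P → ∀ k x y → Dec (WalkP x y k)
  walk? P? zero x y with x Finₚ.≟ y | P? x
  ... | yes refl | yes px = yes (here px)
  ... | yes refl | no ¬px = no λ { (here px) → ¬px px }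
  ... | no x≢y   | _      = no λ { (here _) → x≢y refl }
  walk? P? (suc k) x y with P? x | Finₚ.any? (λ z → T? (adj G x z) ×-dec walk? P? k z y)
  ... | yes px | yes (z , e , p) = yes (step px e p)
  ... | yes _  | no ∄z           = no λ { (step _ e p) → ∄z (_ , e , p) }
  ... | no ¬px | _               = no λ { (step px _ _) → ¬px px }

  IsPath : ∀ {x y k} → WalkP x y k → Set
  IsPath {k = k} p = ∀ i j → i ≤ k → j ≤ k → vertex p i ≡ vertex p j → i ≡ j

  -- a shortest P-walk is a P-path, by shortcut
  path : Decidable P → ∀ {x y k₀} → WalkP x y k₀ → ∃[ k ] Σ (WalkP x y k) IsPath
  path P? {x} {y} p₀ with least (λ k → walk? P? k x y) _ p₀
  ... | k , p , minimal = k , p , no-repeat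
    where
    no-repeat : IsPath p
    no-repeat i j i≤k j≤k same with <-cmp i j
    ... | tri≈ _ i≡j _ = i≡j
    ... | tri< i<j _ _ = let (m , m<k , q) = shortcut p i j i<j j≤k same
                         in ⊥-elim (<⇒≱ m<k (minimal m q))
    ... | tri> _ _ j<i = let (m , m<k , q) = shortcut p j i j<i i≤k (sym same)
                         in ⊥-elim (<⇒≱ m<k (minimal m q))

module Distance (G : Graph) (conn : Connected G) where

  open Walks G

  private V = Fin (n G)

  shortest : ∀ x y → ∃[ m ] Walk G x y m × (∀ j → Walk G x y j → m ≤ j)
  shortest x y = least (λ k → walk? (λ _ → yes tt) k x y) _ (proj₂ (conn x y))

  d : V → V → ℕ
  d x y = proj₁ (shortest x y)

  geodesic : ∀ {x y} → Walk G x y (d x y)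
  geodesic {x} {y} = proj₁ (proj₂ (shortest x y))

  d-min : ∀ {x y m} → Walk G x y m → d x y ≤ m
  d-min {x} {y} {m} = proj₂ (proj₂ (shortest x y)) m

  d-isDist : ∀ {x y} → IsDist G x y (d x y)
  d-isDist = geodesic , λ _ → d-min

  isDist⇒≡d : ∀ {x y k} → IsDist G x y k → k ≡ d x y
  isDist⇒≡d (p , minimal) = ≤-antisym (minimal _ geodesic) (d-min p)

  triangle : ∀ x y z → d x z ≤ d x y + d y z
  triangle x y z = d-min (geodesic {x} {y} ++ geodesic {y} {z})

  d-sym : ∀ x y → d x y ≡ d y x
  d-sym x y = ≤-antisym (d-min (reverse (geodesic {y} {x}))) (d-min (reverse (geodesic {x} {y})))

  d-refl : ∀ x → d x x ≡ 0
  d-refl x = n≤0⇒n≡0 (d-min (here tt))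

  d≡0⇒≡ : ∀ {x y} → d x y ≡ 0 → x ≡ y
  d≡0⇒≡ {x} {y} d≡0 with subst (Walk G x y) d≡0 geodesic
  ... | here _ = refl

  d-adj : ∀ {x y} → Adj G x y → d x y ≤ 1
  d-adj e = d-min (step tt e (here tt))

  d-step : ∀ x {y z} → Adj G y z → d x z ≤ d x y + 1
  d-step x {y} {z} e = ≤-trans (triangle x y z) (+-monoʳ-≤ (d x y) (d-adj e))

  first-step : ∀ x y k → d x y ≡ suc k → ∃[ z ] Adj G x z × d z y ≡ k
  first-step x y k d≡ with subst (Walk G x y) d≡ geodesic
  ... | step {y = z} _ e p = z , e , ≤-antisym (d-min p)
          (+-cancelˡ-≤ 1 k (d z y) (begin
            suc k         ≡⟨ d≡ ⟨
            d x y         ≤⟨ triangle x z y ⟩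
            d x z + d z y ≤⟨ +-monoˡ-≤ (d z y) (d-adj e) ⟩
            1 + d z y     ∎))
    where open ≤-Reasoning

  singleton-setDist : (W : V → Set) {w : V} → W w → (∀ {u} → W u → u ≡ w) →
                      ∀ x → IsSetDist G x W (d x w)
  singleton-setDist W {w} w∈W only-w x =
    (w , w∈W , d-isDist) ,
    λ u u∈W m isDist → subst (λ u → d x u ≤ m) (only-w u∈W) (≤-reflexive (sym (isDist⇒≡d isDist)))

  Beyond : V → V → V → Set
  Beyond x y w = d x w ≡ d x y + d y w

  beyond? : ∀ x y → Decidable (Beyond x y)
  beyond? x y w = d x w ≟ d x y + d y w

  beyond-self : ∀ x y → Beyond x y y
  beyond-self x y = sym (trans (cong (d x y +_) (d-refl y)) (+-identityʳ (d x y)))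

  beyond-antisym : ∀ {x y w} → Beyond x y w → Beyond y x w → x ≡ y
  beyond-antisym {x} {y} {w} xyw yxw = d≡0⇒≡ (m+n≡0⇒m≡0 (d x y) (sym (+-cancelʳ-≡ (d x w) 0 _ (begin
    d x w                       ≡⟨ xyw ⟩
    d x y + d y w               ≡⟨ cong (d x y +_) yxw ⟩
    d x y + (d y x + d x w)     ≡⟨ +-assoc (d x y) (d y x) (d x w) ⟨
    d x y + d y x + d x w       ∎))))
    where open ≡-Reasoning

module Extremal (G : Graph) (conn : Connected G) where

  open Distance G conn

  private V = Fin (n G)

  md-intro : ∀ {u v} → (∀ w → Adj G u w → d v w ≤ d u v) → MaximallyDistant G u v
  md-intro far w e a b a-isDist b-isDist =
    subst₂ _≤_ (sym (isDist⇒≡d a-isDist)) (sym (isDist⇒≡d b-isDist)) (far w e)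

  md-elim : ∀ {u v} → MaximallyDistant G u v → ∀ w → Adj G u w → d v w ≤ d u v
  md-elim md w e = md w e _ _ d-isDist d-isDist

  -- a vertex w farthest from x among those beyond y is maximally distant from x:
  -- a neighbour of w farther from x would itself be beyond y
  farthest-beyond : ∀ x y → ∃[ w ] Beyond x y w × MaximallyDistant G w x
  farthest-beyond x y with maximiser (beyond? x y) (d x) (beyond-self x y)
  ... | w , xyw , farthest = w , xyw , md-intro λ z e → subst (d x z ≤_) (d-sym x w) (no-farther z e)
    where
    no-farther : ∀ z → Adj G w z → d x z ≤ d x w
    no-farther z e with d x z ≤? d x w
    ... | yes closer = closer
    ... | no ¬closer = ⊥-elim (<⇒≱ (≰⇒> ¬closer) (farthest z xyz))
      where
      open ≤-Reasoning
      xyz : Beyond x y z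
      xyz = ≤-antisym (triangle x y z) (begin
        d x y + d y z       ≤⟨ +-monoʳ-≤ (d x y) (d-step y e) ⟩
        d x y + (d y w + 1) ≡⟨ +-assoc (d x y) (d y w) 1 ⟨
        d x y + d y w + 1   ≡⟨ cong (_+ 1) xyw ⟨
        d x w + 1           ≡⟨ +-comm (d x w) 1 ⟩
        suc (d x w)         ≤⟨ ≰⇒> ¬closer ⟩
        d x z               ∎)

  md⇒boundary : ∀ {w v} → MaximallyDistant G w v → InBoundary G w
  md⇒boundary {w} {v} md with farthest-beyond w v
  ... | v′ , wvv′ , v′-md = v′ , md-intro w-far , v′-md
    where
    open ≤-Reasoning
    w-far : ∀ z → Adj G w z → d v′ z ≤ d w v′
    w-far z e = begin
      d v′ z        ≤⟨ triangle v′ v z ⟩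
      d v′ v + d v z ≤⟨ +-monoʳ-≤ (d v′ v) (md-elim md z e) ⟩
      d v′ v + d w v ≡⟨ cong (_+ d w v) (d-sym v′ v) ⟩
      d v v′ + d w v ≡⟨ +-comm (d v v′) (d w v) ⟩
      d w v + d v v′ ≡⟨ wvv′ ⟨
      d w v′         ∎

  -- a simplicial vertex t is maximally distant from every other vertex s:
  -- every neighbour of t is adjacent or equal to the first step from t towards s
  simplicial⇒md : ∀ {s t} → Simplicial G t → s ≢ t → MaximallyDistant G t s
  simplicial⇒md {s} {t} simp s≢t with d t s in dts
  ... | zero  = ⊥-elim (s≢t (sym (d≡0⇒≡ dts)))
  ... | suc k with first-step t s k dts
  ...   | p , tp , dps = md-intro λ z tz → begin
      d s z     ≤⟨ via-p z tz ⟩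
      d s p + 1 ≡⟨ cong (_+ 1) (trans (d-sym s p) dps) ⟩
      k + 1     ≡⟨ +-comm k 1 ⟩
      suc k     ≡⟨ dts ⟨
      d t s     ∎
    where
    open ≤-Reasoning
    via-p : ∀ z → Adj G t z → d s z ≤ d s p + 1
    via-p z tz with z Finₚ.≟ p
    ... | yes refl = m≤m+n (d s z) 1
    ... | no z≢p  = d-step s (simp p z tp tz (z≢p ∘ sym))

  -- a simplicial vertex t outside W never lies between another vertex s and W:
  -- the first step from t towards W would be farther from s than t is
  simplicial-not-between : ∀ {s t} (W : V → Set) → Simplicial G t → s ≢ t → ¬ W t → ¬ Through G W s t
  simplicial-not-between {s} {t} W simp s≢t t∉W
    (a , b , c , (_ , a-min) , b-isDist , ((w , w∈W , c-isDist) , _) , a≡b+c)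
    with d t w in dtw
  ... | zero   = t∉W (subst W (sym (d≡0⇒≡ dtw)) w∈W)
  ... | suc c′ with first-step t w c′ dtw
  ...   | z , tz , dzw = <⇒≱ (+-cancelʳ-≤ c′ (suc (d s t)) (d s z) farther)
                            (subst (d s z ≤_) (d-sym t s) (md-elim (simplicial⇒md simp s≢t) z tz))
    where
    open ≤-Reasoning
    farther : suc (d s t) + c′ ≤ d s z + c′
    farther = begin
      suc (d s t) + c′ ≡⟨ +-suc (d s t) c′ ⟨
      d s t + suc c′   ≡⟨ cong₂ _+_ (isDist⇒≡d b-isDist) (trans (isDist⇒≡d c-isDist) dtw) ⟨
      b + c            ≡⟨ a≡b+c ⟨
      a                ≤⟨ a-min w w∈W (d s w) d-isDist ⟩
      d s w            ≤⟨ triangle s z w ⟩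
      d s z + d z w    ≡⟨ cong (d s z +_) dzw ⟩
      d s z + c′       ∎

  simplicial-unresolved : ∀ {s t} (W : V → Set) → Simplicial G s → Simplicial G t → s ≢ t →
                          ¬ StronglyResolves G W s t
  simplicial-unresolved W simp-s simp-t s≢t (s∉W , t∉W , inj₁ s-t-W) =
    simplicial-not-between W simp-t s≢t t∉W s-t-W
  simplicial-unresolved W simp-s simp-t s≢t (s∉W , t∉W , inj₂ t-s-W) =
    simplicial-not-between W simp-s (s≢t ∘ sym) s∉W t-s-W

  lower-bound : ∀ {m} → Listing (Simplicial G) m → ∀ k → HasSRP G k → m ≤ k
  lower-bound L k (f , _ , resolving) = Finₚ.injective⇒≤ separated
    where
    open Listing L
    separated : Injective _≡_ _≡_ (f ∘ elem)
    separated {i} {j} same with i Finₚ.≟ j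
    ... | yes i≡j = i≡j
    ... | no i≢j  = let i≢j′ = i≢j ∘ elem-injective
                        (W , resolves) = resolving (elem i) (elem j) i≢j′ same
                    in ⊥-elim (simplicial-unresolved (Class G f W) (elem-sat i) (elem-sat j) i≢j′ resolves)

-- Upper bound: if every maximally distant vertex is simplicial, then putting
-- each simplicial vertex in a class of its own, and all other vertices into
-- the first class, gives a strong resolving partition.
module Upper (G : Graph) (conn : Connected G)
             (md⇒simplicial : ∀ {w v} → MaximallyDistant G w v → Simplicial G w) where

  open Distance G conn
  open Extremal G conn

  private V = Fin (n G)

  simplicial-beyond : ∀ x y → ∃[ w ] Simplicial G w × Beyond x y w
  simplicial-beyond x y with farthest-beyond x y
  ... | w , xyw , md = w , md⇒simplicial md , xyw

  module Classes {k} (L : Listing (Simplicial G) (suc k)) where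

    open Listing L

    label : V → Fin (suc k)
    label v with Finₚ.any? (λ i → elem i Finₚ.≟ v)
    ... | yes (i , _) = i
    ... | no _        = zero

    label-elem : ∀ i → label (elem i) ≡ i
    label-elem i with Finₚ.any? (λ j → elem j Finₚ.≟ elem i)
    ... | yes (j , e) = elem-injective e
    ... | no ∄j       = ⊥-elim (∄j (i , refl))

    label-singleton : ∀ v → label v ≢ zero → elem (label v) ≡ v
    label-singleton v label≢0 with Finₚ.any? (λ i → elem i Finₚ.≟ v)
    ... | yes (i , e) = e
    ... | no _        = ⊥-elim (label≢0 refl)

    class-singleton : ∀ {j u} → j ≢ zero → Class G label j u → u ≡ elem j
    class-singleton {u = u} j≢0 refl = sym (label-singleton u j≢0)

    shared-class-is-first : ∀ {x y} → x ≢ y → label x ≡ label y → label x ≡ zero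
    shared-class-is-first {x} {y} x≢y same with label x Finₚ.≟ zero
    ... | yes label≡0 = label≡0
    ... | no label≢0  = ⊥-elim (x≢y (begin
      x              ≡⟨ label-singleton x label≢0 ⟨
      elem (label x) ≡⟨ cong elem same ⟩
      elem (label y) ≡⟨ label-singleton y (label≢0 ∘ trans same) ⟩
      y              ∎))
      where open ≡-Reasoning

    resolved-by : ∀ {x y j} → label x ≡ zero → label y ≡ zero → j ≢ zero → Beyond x y (elem j) →
                  StronglyResolves G (Class G label j) x y
    resolved-by {x} {y} {j} x∈first y∈first j≢0 xyw =
      (λ x∈j → j≢0 (trans (sym x∈j) x∈first)) ,
      (λ y∈j → j≢0 (trans (sym y∈j) y∈first)) ,
      inj₁ (_ , _ , _ , to-class x , d-isDist , to-class y , xyw)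
      where
      to-class : ∀ v → IsSetDist G v (Class G label j) (d v (elem j))
      to-class = singleton-setDist (Class G label j) (label-elem j) (class-singleton j≢0)

    -- x, y in the first class: the simplicial vertices w₁ beyond y (from x)
    -- and w₂ beyond x (from y) differ, so one of them has a singleton class
    first-class-resolved : ∀ {x y} → x ≢ y → label x ≡ zero → label y ≡ zero →
                           ∃[ j ] StronglyResolves G (Class G label j) x y
    first-class-resolved {x} {y} x≢y x∈first y∈first with simplicial-beyond x y | simplicial-beyond y x
    ... | w₁ , s₁ , xyw₁ | w₂ , s₂ , yxw₂ with elem-onto s₁ | elem-onto s₂
    ...   | i₁ , refl | i₂ , refl with i₁ Finₚ.≟ zero
    ...     | no i₁≢0  = i₁ , resolved-by x∈first y∈first i₁≢0 xyw₁
    ...     | yes i₁≡0 = i₂ , swap-resolves G (resolved-by y∈first x∈first i₂≢0 yxw₂)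
      where
      i₂≢0 : i₂ ≢ zero
      i₂≢0 i₂≡0 = x≢y (beyond-antisym xyw₁ (subst (Beyond y x ∘ elem) (trans i₂≡0 (sym i₁≡0)) yxw₂))

    resolving : ∀ x y → x ≢ y → label x ≡ label y → ∃[ j ] StronglyResolves G (Class G label j) x y
    resolving x y x≢y same = first-class-resolved x≢y x∈first (trans (sym same) x∈first)
      where
      x∈first : label x ≡ zero
      x∈first = shared-class-is-first x≢y same

  upper-bound : ∀ {m} → Listing (Simplicial G) m → HasSRP G m
  upper-bound {zero} L = (⊥-elim ∘ no-vertex) , (λ ()) , λ x → ⊥-elim (no-vertex x)
    where
    no-vertex : V → ⊥
    no-vertex v = Finₚ.¬Fin0 (proj₁ (Listing.elem-onto L (proj₁ (proj₂ (simplicial-beyond v v)))))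
  upper-bound {suc k} L = label , (λ i → elem i , label-elem i) , resolving
    where
    open Listing L
    open Classes L

pd-simplicial : (G : Graph) → Connected G → (∀ {w v} → MaximallyDistant G w v → Simplicial G w) →
                ∀ {m} → Listing (Simplicial G) m → PDs G m
pd-simplicial G conn md⇒simplicial L = Upper.upper-bound G conn md⇒simplicial L , Extremal.lower-bound G conn L

module Avoiding (G : Graph) (conn : Connected G) where

  open Walks G
  open Distance G conn
  open Extremal G conn using (md-elim)

  avoid-or-detour : ∀ w {x y k} → Walk G x y k → WalkIn G (_≢ w) x y k ⊎ d x w + d w y ≤ k
  avoid-or-detour w (here {x} _) with x Finₚ.≟ w
  ... | yes refl = inj₂ (≤-reflexive (cong₂ _+_ (d-refl w) (d-refl w)))
  ... | no x≢w   = inj₁ (here x≢w)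
  avoid-or-detour w {x} {y} {suc k} p@(step {y = x′} _ e q) with x Finₚ.≟ w | avoid-or-detour w q
  ... | yes refl | _        = inj₂ (subst (_≤ suc k) (cong (_+ d w y) (sym (d-refl w))) (d-min p))
  ... | no x≢w   | inj₁ q′  = inj₁ (step x≢w e q′)
  ... | no x≢w   | inj₂ long = inj₂ (begin
      d x w + d w y          ≤⟨ +-monoˡ-≤ (d w y) (triangle x x′ w) ⟩
      d x x′ + d x′ w + d w y ≤⟨ +-monoˡ-≤ (d w y) (+-monoˡ-≤ (d x′ w) (d-adj e)) ⟩
      suc (d x′ w + d w y)    ≤⟨ s≤s long ⟩
      suc k                   ∎)
    where open ≤-Reasoning

  geodesic-avoids : ∀ {w a v} → Adj G w a → d a v ≤ d w v → WalkIn G (_≢ w) a v (d a v)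
  geodesic-avoids {w} {a} {v} wa a-nearer with avoid-or-detour w (geodesic {a} {v})
  ... | inj₁ avoiding = avoiding
  ... | inj₂ detour   = ⊥-elim (adj-irrefl G (subst (Adj G w) (d≡0⇒≡ daw≡0) wa))
    where
    daw≡0 : d a w ≡ 0
    daw≡0 = n≤0⇒n≡0 (+-cancelʳ-≤ (d w v) (d a w) 0 (≤-trans detour a-nearer))

  -- any two neighbours of a vertex w maximally distant from v are joined
  -- by a walk avoiding w: follow geodesics through v
  neighbours-joined : ∀ {w v a b} → MaximallyDistant G w v → Adj G w a → Adj G w b →
                      ∃[ k ] WalkIn G (_≢ w) a b k
  neighbours-joined {w} {v} md wa wb =
    _ , (geodesic-avoids wa (nearer wa) ++ reverse (geodesic-avoids wb (nearer wb)))
    where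
    nearer : ∀ {c} → Adj G w c → d c v ≤ d w v
    nearer {c} wc = subst (_≤ d w v) (d-sym v c) (md-elim md c wc)

  simplicial-neighbours : ∀ {u p q} → Simplicial G u → Adj G u p → Adj G u q → d p q ≤ 1
  simplicial-neighbours {u} {p} {q} simp up uq with p Finₚ.≟ q
  ... | yes refl = ≤-trans (≤-reflexive (d-refl p)) z≤n
  ... | no p≢q   = d-adj (simp p q up uq p≢q)

  -- a simplicial vertex u is not a cut vertex: a geodesic through u could be
  -- shortened by skipping u between its two neighbours on it
  simplicial-not-cut : ∀ {u} → Simplicial G u → ¬ IsCutVertex G u
  simplicial-not-cut {u} simp (x , y , x≢u , y≢u , disconnected)
    with avoid-or-detour u (geodesic {x} {y})
  ... | inj₁ avoiding = disconnected (_ , avoiding)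
  ... | inj₂ detour with d u x in dux | d u y in duy
  ...   | zero  | _     = x≢u (sym (d≡0⇒≡ dux))
  ...   | suc _ | zero  = y≢u (sym (d≡0⇒≡ duy))
  ...   | suc i | suc j with first-step u x i dux | first-step u y j duy
  ...     | p , up , dpx | q , uq , dqy = 1+n≰n (begin
      suc (i + suc j)       ≡⟨ cong (_+ suc j) (trans (d-sym x u) dux) ⟨
      d x u + suc j         ≤⟨ detour ⟩
      d x y                 ≤⟨ triangle x p y ⟩
      d x p + d p y         ≤⟨ +-monoʳ-≤ (d x p) (triangle p q y) ⟩
      d x p + (d p q + d q y) ≤⟨ +-monoʳ-≤ (d x p) (+-monoˡ-≤ (d q y) (simplicial-neighbours simp up uq)) ⟩
      d x p + (1 + d q y)   ≡⟨ cong₂ (λ s t → s + suc t) (trans (d-sym x p) dpx) dqy ⟩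
      i + suc j             ∎)
    where open ≤-Reasoning

∣p∣≥1 : ∀ {N} {p : Subset N} {a} → a ∈ p → 1 ≤ ∣ p ∣
∣p∣≥1 a∈p = ≤-<-trans z≤n (x∈p⇒∣p-x∣<∣p∣ a∈p)

∣p∣≥2 : ∀ {N} {p : Subset N} {a b} → a ∈ p → b ∈ p → b ≢ a → 2 ≤ ∣ p ∣
∣p∣≥2 a∈p b∈p b≢a = ≤-<-trans (∣p∣≥1 (x∈p∧x≢y⇒x∈p-y b∈p b≢a)) (x∈p⇒∣p-x∣<∣p∣ a∈p)

∣p∣≤1 : ∀ {N} {p : Subset N} {a} → (∀ {x} → x ∈ p → x ≡ a) → ∣ p ∣ ≤ 1
∣p∣≤1 {p = p} {a} only-a =
  subst (∣ p ∣ ≤_) (∣⁅x⁆∣≡1 a) (p⊆q⇒∣p∣≤∣q∣ λ x∈p → subst (_∈ ⁅ a ⁆) (sym (only-a x∈p)) (x∈⁅x⁆ a))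

-- Two different neighbours a, b of w joined by a walk avoiding w close a
-- cycle: w followed by a shortest such walk.
module Cycles (G : Graph) where

  open Walks G

  cycle : ∀ {w a b k} → a ≢ b → Adj G w a → Adj G w b → WalkIn G (_≢ w) a b k → HasCycle G
  cycle {w} {a} {b} a≢b wa wb walk with path (λ v → ¬? (v Finₚ.≟ w)) walk
  ... | zero  , p , _      = ⊥-elim (a≢b (vertex-last p))
  ... | suc m , p , p-path = m , vs , vs-injective , vs-adj , closing
    where
    vs : Fin (suc (suc (suc m))) → Fin (n G)
    vs zero    = w
    vs (suc i) = vertex p (toℕ i)

    vs-injective : Injective _≡_ _≡_ vs
    vs-injective {zero}  {zero}  _ = refl
    vs-injective {zero}  {suc j} e = ⊥-elim (vertex-sat p (toℕ j) (sym e))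
    vs-injective {suc i} {zero}  e = ⊥-elim (vertex-sat p (toℕ i) e)
    vs-injective {suc i} {suc j} e =
      cong suc (Finₚ.toℕ-injective (p-path _ _ (Finₚ.toℕ≤pred[n] i) (Finₚ.toℕ≤pred[n] j) e))

    vs-adj : (i : Fin (suc (suc m))) → Adj G (vs (inject₁ i)) (vs (suc i))
    vs-adj zero    = wa
    vs-adj (suc i) = subst (λ l → Adj G (vertex p l) (vertex p (suc (toℕ i))))
                           (sym (Finₚ.toℕ-inject₁ i)) (vertex-adj p (toℕ i) (Finₚ.toℕ<n i))

    closing : Adj G (vs (fromℕ (suc (suc m)))) (vs zero)
    closing = subst (λ u → Adj G u w)
                    (sym (trans (cong (vertex p ∘ suc) (Finₚ.toℕ-fromℕ m)) (vertex-last p)))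
                    (adj-sym G wb)

another : ∀ {N} → 2 ≤ N → (u : Fin N) → ∃[ y ] y ≢ u
another (s≤s (s≤s _)) zero    = suc zero , λ ()
another (s≤s (s≤s _)) (suc _) = zero , λ ()

module Trees (G : Graph) (tree : IsTree G) where

  private
    conn : Connected G
    conn = proj₁ tree
    acyclic : ¬ HasCycle G
    acyclic = proj₂ tree
    neighbours : Fin (n G) → Subset (n G)
    neighbours u = tabulate (adj G u)

  open Distance G conn using (d; d≡0⇒≡; first-step)
  open Avoiding G conn using (neighbours-joined)
  open Cycles G using (cycle)

  -- a maximally distant vertex has no two different neighbours: they would close a cycle
  md⇒simplicial : ∀ {w v} → MaximallyDistant G w v → Simplicial G w
  md⇒simplicial md a b wa wb a≢b = ⊥-elim (acyclic (cycle a≢b wa wb (proj₂ (neighbours-joined md wa wb))))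

  leaf⇒simplicial : ∀ {u} → u ∈ leaves G → Simplicial G u
  leaf⇒simplicial {u} leaf a b ua ub a≢b = ⊥-elim (
    <⇒≱ (∣p∣≥2 (∈-tabulate⁺ (adj G u) ua) (∈-tabulate⁺ (adj G u) ub) (a≢b ∘ sym))
        (≤-reflexive (≡ᵇ⇒≡ (degree G u) 1 (∈-tabulate⁻ (λ v → degree G v ≡ᵇ 1) leaf))))

  -- a simplicial vertex has a neighbour (as G is connected with ≥ 2 vertices),
  -- and no second one, as two neighbours would form a triangle
  simplicial⇒leaf : 2 ≤ n G → ∀ {u} → Simplicial G u → u ∈ leaves G
  simplicial⇒leaf two {u} simp with another two u
  ... | y , y≢u with d u y in duy
  ...   | zero  = ⊥-elim (y≢u (sym (d≡0⇒≡ duy)))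
  ...   | suc k with first-step u y k duy
  ...     | a , ua , _ = ∈-tabulate⁺ (λ v → degree G v ≡ᵇ 1)
                           (≡⇒≡ᵇ (degree G u) 1 (≤-antisym (∣p∣≤1 only-a) (∣p∣≥1 (∈-tabulate⁺ (adj G u) ua))))
    where
    only-a : ∀ {b} → b ∈ neighbours u → b ≡ a
    only-a {b} b∈ with b Finₚ.≟ a
    ... | yes b≡a = b≡a
    ... | no b≢a  = ⊥-elim (acyclic (cycle b≢a ub ua
                      (step (adj⇒≢ G ub) (simp b a ub ua b≢a) (here (adj⇒≢ G ua)))))
      where
      ub : Adj G u b
      ub = ∈-tabulate⁻ (adj G u) b∈

  leaf⇔simplicial : 2 ≤ n G → ∀ u → u ∈ leaves G ⇔ Simplicial G u
  leaf⇔simplicial two u = mk⇔ leaf⇒simplicial (simplicial⇒leaf two)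

-- The vertex set S of the cycle formed by w and a path p from a neighbour a
-- to a neighbour b of w avoiding w.  S is nonseparable: every vertex of S
-- reaches w inside S, and after deleting any v ∈ S every other vertex of S
-- reaches a along p (if v = w) or w around the cycle (if v lies on p).
module CycleSet (G : Graph) {w a b : Fin (n G)} {k : ℕ}
                (p : WalkIn G (_≢ w) a b k) (p-path : Walks.IsPath G p)
                (wa : Adj G w a) (wb : Adj G w b) where

  open Walks G

  private V = Fin (n G)

  OnCycle : V → Set
  OnCycle v = v ≡ w ⊎ ∃[ i ] vertex p (toℕ {suc k} i) ≡ v

  on-cycle? : Decidable OnCycle
  on-cycle? v = (v Finₚ.≟ w) ⊎-dec Finₚ.any? (λ i → vertex p (toℕ i) Finₚ.≟ v)

  S : Subset (n G)
  S = tabulate (⌊_⌋ ∘ on-cycle?)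

  ∈S⁺ : ∀ {v} → OnCycle v → v ∈ S
  ∈S⁺ on = ∈-tabulate⁺ (⌊_⌋ ∘ on-cycle?) (fromWitness on)

  ∈S⁻ : ∀ {v} → v ∈ S → OnCycle v
  ∈S⁻ v∈S = toWitness (∈-tabulate⁻ (⌊_⌋ ∘ on-cycle?) v∈S)

  w∈S : w ∈ S
  w∈S = ∈S⁺ (inj₁ refl)

  vertex∈S : ∀ l → l ≤ k → vertex p l ∈ S
  vertex∈S l l≤k = ∈S⁺ (inj₂ (fromℕ< (s≤s l≤k) , cong (vertex p) (Finₚ.toℕ-fromℕ< (s≤s l≤k))))

  a∈S : a ∈ S
  a∈S = vertex∈S 0 z≤n

  b∈S : b ∈ S
  b∈S = subst (_∈ S) (vertex-last p) (vertex∈S k ≤-refl)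

  w-off-p : ∀ l → w ≢ vertex p l
  w-off-p l w≡v = vertex-sat p l (sym w≡v)

  private
    index≤ : (i : Fin (suc k)) → toℕ i ≤ k
    index≤ = Finₚ.toℕ≤pred[n]

    S-minus : V → V → Set
    S-minus v z = z ∈ S × z ≢ v

  initial : (Q : V → Set) → ∀ j → j ≤ k → (∀ l → l ≤ j → Q (vertex p l)) → WalkIn G Q (vertex p j) a j
  initial Q j j≤k inQ = reverse (segment p Q 0 j z≤n j≤k (λ l _ l≤j → inQ l l≤j))

  final : (Q : V → Set) → ∀ j → j ≤ k → (∀ l → j ≤ l → l ≤ k → Q (vertex p l)) →
          WalkIn G Q (vertex p j) b (k ∸ j)
  final Q j j≤k inQ = subst (λ u → WalkIn G Q (vertex p j) u (k ∸ j)) (vertex-last p) (segment p Q j k j≤k ≤-refl inQ)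

  to-w : ∀ {x} → x ∈ S → ∃[ m ] WalkIn G (_∈ S) x w m
  to-w x∈S with ∈S⁻ x∈S
  ... | inj₁ refl    = 0 , here w∈S
  ... | inj₂ (i , refl) =
    _ , snoc (initial (_∈ S) (toℕ i) (index≤ i) (λ l l≤i → vertex∈S l (≤-trans l≤i (index≤ i)))) w∈S (adj-sym G wa)

  -- deleting w: p itself avoids w
  around-w : ∀ {x} → x ∈ S → x ≢ w → ∃[ m ] WalkIn G (S-minus w) x a m
  around-w x∈S x≢w with ∈S⁻ x∈S
  ... | inj₁ x≡w        = ⊥-elim (x≢w x≡w)
  ... | inj₂ (i , refl) =
    _ , initial (S-minus w) (toℕ i) (index≤ i) (λ l l≤i → vertex∈S l (≤-trans l≤i (index≤ i)) , vertex-sat p l)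

  -- deleting the r-th vertex of p: go back to a, or on to b, then to w
  around-p : ∀ r {x} → x ∈ S → x ≢ vertex p (toℕ r) → ∃[ m ] WalkIn G (S-minus (vertex p (toℕ r))) x w m
  around-p r x∈S x≢v with ∈S⁻ x∈S
  ... | inj₁ refl = 0 , here (w∈S , w-off-p (toℕ r))
  ... | inj₂ (j , refl) with <-cmp (toℕ j) (toℕ r)
  ...   | tri≈ _ j≡r _ = ⊥-elim (x≢v (cong (vertex p) j≡r))
  ...   | tri< j<r _ _ = _ , snoc
          (initial (S-minus (vertex p (toℕ r))) (toℕ j) (index≤ j) λ l l≤j →
            vertex∈S l (≤-trans l≤j (index≤ j)) ,
            <⇒≢ (≤-<-trans l≤j j<r) ∘ p-path l (toℕ r) (≤-trans l≤j (index≤ j)) (index≤ r))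
          (w∈S , w-off-p (toℕ r)) (adj-sym G wa)
  ...   | tri> _ _ r<j = _ , snoc
          (final (S-minus (vertex p (toℕ r))) (toℕ j) (index≤ j) λ l j≤l l≤k →
            vertex∈S l l≤k ,
            <⇒≢ (<-≤-trans r<j j≤l) ∘ sym ∘ p-path l (toℕ r) l≤k (index≤ r))
          (w∈S , w-off-p (toℕ r)) (adj-sym G wb)

  nonseparable : Nonseparable G S
  nonseparable = (λ x y x∈S y∈S → meet (to-w x∈S) (to-w y∈S)) , without
    where
    without : ∀ v x y → v ∈ S → x ∈ S → y ∈ S → x ≢ v → y ≢ v → ∃[ m ] WalkIn G (S-minus v) x y m
    without v x y v∈S x∈S y∈S x≢v y≢v with ∈S⁻ v∈S
    ... | inj₁ refl       = meet (around-w x∈S x≢v) (around-w y∈S y≢v)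
    ... | inj₂ (r , refl) = meet (around-p r x∈S x≢v) (around-p r y∈S y≢v)

module BlockGraphs (G : Graph) (block-graph : IsBlockGraph G) where

  open Walks G

  -- a nonempty nonseparable set lies (constructively: not not) in a block:
  -- otherwise it is itself a block, since a nonseparable proper superset
  -- lies in a block by induction on ⊃
  within-block : ∀ {S x} → x ∈ S → Nonseparable G S → ¬ ¬ (∃[ B ] IsBlock G B × S ⊆ B)
  within-block {S} x∈S nonsep = grow S (⊃-wellFounded S) x∈S nonsep
    where
    grow : ∀ S {x} → Acc _⊃_ S → x ∈ S → Nonseparable G S → ¬ ¬ (∃[ B ] IsBlock G B × S ⊆ B)
    grow S {x} (acc larger) x∈S nonsep no-block = no-block (S , ((x , x∈S) , nonsep , maximal) , λ v∈S → v∈S)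
      where
      maximal : ∀ B′ → Nonseparable G B′ → S ⊆ B′ → B′ ⊆ S
      maximal B′ nonsep′ S⊆B′ {v} v∈B′ with v ∈? S
      ... | yes v∈S = v∈S
      ... | no v∉S  = ⊥-elim (grow B′ (larger (S⊆B′ , v , v∈B′ , v∉S)) (S⊆B′ x∈S) nonsep′
                        λ (B , block , B′⊆B) → no-block (B , block , B′⊆B ∘ S⊆B′))

  -- two different neighbours of w joined avoiding w are adjacent: the cycle
  -- they close lies in a block, which is a clique
  neighbours-adjacent : ∀ {w a b k} → a ≢ b → Adj G w a → Adj G w b → WalkIn G (_≢ w) a b k → Adj G a b
  neighbours-adjacent {w} {a} {b} a≢b wa wb walk with T? (adj G a b)
  ... | yes ab = ab
  ... | no ¬ab with path (λ v → ¬? (v Finₚ.≟ w)) walk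
  ...   | _ , p , p-path = ⊥-elim (within-block a∈S nonseparable λ (B , block , S⊆B) →
                             ¬ab (block-graph B block a b (S⊆B a∈S) (S⊆B b∈S) a≢b))
    where open CycleSet G p p-path wa wb

  md⇒simplicial : Connected G → ∀ {w v} → MaximallyDistant G w v → Simplicial G w
  md⇒simplicial conn md a b wa wb a≢b =
    neighbours-adjacent a≢b wa wb (proj₂ (Avoiding.neighbours-joined G conn md wa wb))

  not-cut⇒simplicial : ∀ {u} → ¬ IsCutVertex G u → Simplicial G u
  not-cut⇒simplicial not-cut a b ua ub a≢b with T? (adj G a b)
  ... | yes ab = ab
  ... | no ¬ab = ⊥-elim (not-cut (a , b , adj⇒≢ G ua , adj⇒≢ G ub , λ (_ , walk) → ¬ab (neighbours-adjacent a≢b ua ub walk)))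

  simplicial⇔not-cut : Connected G → (C : Subset (n G)) → (∀ u → u ∈ C ⇔ IsCutVertex G u) →
                       ∀ u → u ∈ ∁ C ⇔ Simplicial G u
  simplicial⇔not-cut conn C C⇔cut u = mk⇔
    (λ u∈∁C → not-cut⇒simplicial (x∈∁p⇒x∉p u∈∁C ∘ Equivalence.from (C⇔cut u)))
    (λ simp → x∉p⇒x∈∁p (Avoiding.simplicial-not-cut G conn simp ∘ Equivalence.to (C⇔cut u)))

module Complete (m : ℕ) where

  adjacent : ∀ {x y : Fin m} → x ≢ y → Adj (K m) x y
  adjacent {x} {y} x≢y with x Finₚ.≟ y
  ... | yes x≡y = x≢y x≡y
  ... | no _    = tt

  connected : Connected (K m)
  connected x y with x Finₚ.≟ y
  ... | yes refl = 0 , here tt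
  ... | no x≢y   = 1 , step tt (adjacent x≢y) (here tt)

  simplicial : ∀ u → Simplicial (K m) u
  simplicial u a b _ _ = adjacent

  all-vertices : Listing (Simplicial (K m)) m
  all-vertices = record
    { elem = λ u → u ; elem-injective = λ e → e ; elem-sat = simplicial ; elem-onto = λ {v} _ → v , refl }

boundary-theorem : (G : Graph) → Connected G → (∀ u → InBoundary G u ⇔ Simplicial G u) →
                   (B : Subset (n G)) → (∀ u → u ∈ B ⇔ InBoundary G u) → PDs G ∣ B ∣
boundary-theorem G conn ∂⇔simplicial B B⇔∂ =
  pd-simplicial G conn (Equivalence.to (∂⇔simplicial _) ∘ Extremal.md⇒boundary G conn)
    (relist (λ u → ∂⇔simplicial u ⇔-∘ B⇔∂ u) (enumerate B))

theorem12 :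
    ((G : Graph) → Connected G → (∀ u → InBoundary G u ⇔ Simplicial G u) →
      (B : Subset (n G)) → (∀ u → u ∈ B ⇔ InBoundary G u) → PDs G ∣ B ∣)
    × ((m : ℕ) → 1 ≤ m → PDs (K m) m)
    × ((T : Graph) → 2 ≤ n T → IsTree T → PDs T ∣ leaves T ∣)
    × ((G : Graph) → Connected G → IsBlockGraph G →
      (C : Subset (n G)) → (∀ u → u ∈ C ⇔ IsCutVertex G u) → PDs G (n G ∸ ∣ C ∣))
theorem12 = boundary-theorem , complete , tree , block-graph
  where
  complete : (m : ℕ) → 1 ≤ m → PDs (K m) m
  complete m _ = pd-simplicial (K m) connected (λ {w} _ → simplicial w) all-vertices
    where open Complete m

  tree : (T : Graph) → 2 ≤ n T → IsTree T → PDs T ∣ leaves T ∣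
  tree T two is-tree = pd-simplicial T (proj₁ is-tree) md⇒simplicial
    (relist (leaf⇔simplicial two) (enumerate (leaves T)))
    where open Trees T is-tree

  block-graph : (G : Graph) → Connected G → IsBlockGraph G →
                (C : Subset (n G)) → (∀ u → u ∈ C ⇔ IsCutVertex G u) → PDs G (n G ∸ ∣ C ∣)
  block-graph G conn is-block-graph C C⇔cut = subst (PDs G) (∣∁p∣≡n∸∣p∣ C)
    (pd-simplicial G conn (md⇒simplicial conn) (relist (simplicial⇔not-cut conn C C⇔cut) (enumerate (∁ C))))
    where open BlockGraphs G is-block-graph
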